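{- Let $A$ be a finite set of actions equipped with an involution $\mathrm{dual}_A$. Let $\mathcal{L}$ and $\mathcal{M}$ be disjoint finite sets of locations, let $\mathbf{A}$ and $\mathbf{B}$ be $\mathcal{L}_A$-LTSs, let $\mathbf{C}$ be an $\mathcal{M}_A$-LTS, and let $\sigma$ be a partial injection from $\mathcal{L}$ to $\mathcal{M}$. If $\mathbf{A}\approx\mathbf{B}$, then $\mathbf{A}\,||_\sigma\,\mathbf{C}\approx\mathbf{B}\,||_\sigma\,\mathbf{C}$.
   Context: For a set $X$, $\mathbb{FM}(X)$ denotes the set of finite multisets over $X$; multiset union $\cup$ adds multiplicities; $\emptyset$ is the empty multiset. For a finite set of locations $\mathcal{L}$, $\mathcal{L}_A$ denotes $\mathbb{FM}(\mathcal{L}\times A)$. An $\mathcal{L}_A$-LTS (locative transition system) is a triple $\mathbf{A}=(S_\mathbf{A},\rightarrow_\mathbf{A},s_\mathbf{A})$ with a set of states $S_\mathbf{A}$, an initial state $s_\mathbf{A}\in S_\mathbf{A}$, and a transition relation $\rightarrow_\mathbf{A}\subseteq S_\mathbf{A}\times\mathcal{L}_A\times S_\mathbf{A}$; write $u\xrightarrow{\mathsf a}t$ for $(u,\mathsf a,t)\in\rightarrow_\mathbf{A}$. Given disjoint $\mathcal{L},\mathcal{M}$ and a partial injection $\sigma$ from $\mathcal{L}$ to $\mathcal{M}$ (a bijection $\mathrm{dom}(\sigma)\to\mathrm{rng}(\sigma)$ with $\mathrm{dom}(\sigma)\subseteq\mathcal{L}$, $\mathrm{rng}(\sigma)\subseteq\mathcal{M}$),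 a multiset over $(\mathcal{L}\cup\mathcal{M})\times A$ is $\sigma$-dual if it has the form $\{\!|(\ell_1,a_1),\dots,(\ell_n,a_n),(\sigma(\ell_1),b_1),\dots,(\sigma(\ell_n),b_n)|\!\}$ with $\ell_i\in\mathrm{dom}(\sigma)$ and $b_i=\mathrm{dual}_A(a_i)$ for all $i$; the set of these is $\bot_\sigma$. The $\sigma$-parallel composition $\mathbf{A}\,||_\sigma\,\mathbf{C}$ of an $\mathcal{L}_A$-LTS $\mathbf{A}$ and an $\mathcal{M}_A$-LTS $\mathbf{C}$ is the $\mathcal{N}_A$-LTS with $\mathcal{N}=(\mathcal{L}\cup\mathcal{M})\setminus(\mathrm{dom}(\sigma)\cup\mathrm{rng}(\sigma))$, states $S_\mathbf{A}\times S_\mathbf{C}$, initial state $(s_\mathbf{A},s_\mathbf{C})$, and transitions $\leadsto$ the union of: (i) $(u_\mathbf{A},u_\mathbf{C})\overset{\mathsf a}{\leadsto}(t_\mathbf{A},u_\mathbf{C})$ whenever $\mathsf a\in(\mathcal{L}\setminus\mathrm{dom}(\sigma))_A$ and $u_\mathbf{A}\xrightarrow{\mathsf a}t_\mathbf{A}$; (ii) $(u_\mathbf{A},u_\mathbf{C})\overset{\mathsf a}{\leadsto}(u_\mathbf{A},t_\mathbf{C})$ whenever $\mathsf a\in(\mathcal{M}\setminus\mathrm{rng}(\sigma))_A$ and $u_\mathbf{C}\xrightarrow{\mathsf a}t_\mathbf{C}$; (iii) $(u_\mathbf{A},u_\mathbf{C})\overset{\mathsf a}{\leadsto}(t_\mathbf{A},t_\mathbf{C})$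 whenever there are $\mathsf d\in\bot_\sigma$, $\mathsf b\in\mathcal{L}_A$, $\mathsf c\in\mathcal{M}_A$ with $u_\mathbf{A}\xrightarrow{\mathsf b}t_\mathbf{A}$, $u_\mathbf{C}\xrightarrow{\mathsf c}t_\mathbf{C}$ and $\mathsf a\cup\mathsf d=\mathsf b\cup\mathsf c$. In any such LTS the weak transition relation is defined by $\overset{\mathsf a}{\Rightarrow}=(\xrightarrow{\emptyset})^*\xrightarrow{\mathsf a}(\xrightarrow{\emptyset})^*$ if $\mathsf a\neq\emptyset$ and $\overset{\emptyset}{\Rightarrow}=(\xrightarrow{\emptyset})^*$. A weak bisimulation between two LTSs $\mathbf{A},\mathbf{B}$ over the same label set is a relation $\mathcal{R}\subseteq S_\mathbf{A}\times S_\mathbf{B}$ with $s_\mathbf{A}\,\mathcal{R}\,s_\mathbf{B}$ such that whenever $u\,\mathcal{R}\,t$: if $u\xrightarrow{\mathsf a}v$ then $t\overset{\mathsf a}{\Rightarrow}w$ for some $w$ with $v\,\mathcal{R}\,w$, and if $t\xrightarrow{\mathsf a}w$ then $u\overset{\mathsf a}{\Rightarrow}v$ for some $v$ with $v\,\mathcal{R}\,w$. $\mathbf{A}\approx\mathbf{B}$ means such a weak bisimulation exists. -}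

module Defs where

open import Data.Nat using (ℕ; _+_)
open import Data.Fin using (Fin; _≟_; _↑ˡ_; _↑ʳ_)
open import Data.Vec using (Vec; replicate; zipWith; tabulate; lookup; _++_)
open import Data.Maybe using (Maybe; just; nothing)
open import Data.Product using (Σ; ∃; _×_; _,_)
open import Data.Sum using (_⊎_)
open import Data.List using (List; []; _∷_)
open import Data.List.Relation.Unary.All using (All)
open import Data.Bool using (if_then_else_; _∧_)
open import Relation.Nullary using (¬_)
open import Relation.Nullary.Decidable using (⌊_⌋)
open import Relation.Binary.PropositionalEquality using (_≡_)
open import Relation.Binary.Construct.Closure.ReflexiveTransitive using (Star)

-- Finite sets are modelled as Fin n.  A finite multiset over
-- Fin n × Fin k is a table of multiplicities (first-order data, so
-- propositional equality is equality of multisets).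

Mset : ℕ → ℕ → Set
Mset n k = Vec (Vec ℕ k) n

∅ᴹ : ∀ {n k} → Mset n k
∅ᴹ {n} {k} = replicate n (replicate k 0)

_∪ᴹ_ : ∀ {n k} → Mset n k → Mset n k → Mset n k
_∪ᴹ_ = zipWith (zipWith _+_)

mult : ∀ {n k} → Mset n k → Fin n → Fin k → ℕ
mult m i x = lookup (lookup m i) x

single : ∀ {n k} → Fin n → Fin k → Mset n k
single i x = tabulate λ j → tabulate λ y →
  if ⌊ i ≟ j ⌋ ∧ ⌊ x ≟ y ⌋ then 1 else 0

record LTS (Lab : Set) : Set₁ where
  field
    State : Set
    init  : State
    _⟶⟨_⟩_ : State → Lab → State → Set

module _ {Lab : Set} (∅ : Lab) (T : LTS Lab) where
  open LTS T

  τ-step : State → State → Set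
  τ-step u t = u ⟶⟨ ∅ ⟩ t

  data Weak : State → Lab → State → Set where
    weak-∅ : ∀ {u t} → Star τ-step u t → Weak u ∅ t
    weak-a : ∀ {u v v′ t a} → ¬ (a ≡ ∅) →
             Star τ-step u v → v ⟶⟨ a ⟩ v′ → Star τ-step v′ t → Weak u a t

record IsWeakBisim {Lab : Set} (∅ : Lab) (T U : LTS Lab)
                   (R : LTS.State T → LTS.State U → Set) : Set where
  open LTS T renaming (_⟶⟨_⟩_ to _⟶₁⟨_⟩_)
  open LTS U renaming (_⟶⟨_⟩_ to _⟶₂⟨_⟩_)
  field
    init-rel : R (LTS.init T) (LTS.init U)
    forth : ∀ {u t a v} → R u t → u ⟶₁⟨ a ⟩ v →
            Σ (LTS.State U) λ w → Weak ∅ U t a w × R v w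
    back  : ∀ {u t a w} → R u t → t ⟶₂⟨ a ⟩ w →
            Σ (LTS.State T) λ v → Weak ∅ T u a v × R v w

WeakBisimilar : {Lab : Set} (∅ : Lab) (T U : LTS Lab) → Set₁
WeakBisimilar ∅ T U =
  Σ (LTS.State T → LTS.State U → Set) λ R → IsWeakBisim ∅ T U R

record PInj (nL nM : ℕ) : Set where
  field
    map : Fin nL → Maybe (Fin nM)
    inj : ∀ {l l′ m} → map l ≡ just m → map l′ ≡ just m → l ≡ l′

record Involution (nA : ℕ) : Set where
  field
    dual    : Fin nA → Fin nA
    dual-invol : ∀ a → dual (dual a) ≡ a

module Composition {nA nL nM : ℕ} (D : Involution nA) (σ : PInj nL nM) where
  open Involution D
  open PInj σ

  -- Locations L ∪ M (disjoint) are Fin (nL + nM): L via inject+, M via raise.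
  Lab : Set
  Lab = Mset (nL + nM) nA

  embedL : Mset nL nA → Lab
  embedL b = b ++ ∅ᴹ

  embedM : Mset nM nA → Lab
  embedM c = ∅ᴹ {nL} ++ c

  OffDom : Mset nL nA → Set
  OffDom a = ∀ l m x → map l ≡ just m → mult a l x ≡ 0

  OffRng : Mset nM nA → Set
  OffRng a = ∀ l m x → map l ≡ just m → mult a m x ≡ 0

  Bound : Fin (nL + nM) → Set
  Bound i = ∃ λ l → ∃ λ m → map l ≡ just m ×
            (i ≡ l ↑ˡ nM ⊎ i ≡ nL ↑ʳ m)

  InN : Lab → Set
  InN a = ∀ i x → Bound i → mult a i x ≡ 0

  dualMS : List (Fin nL × Fin nM × Fin nA) → Lab
  dualMS [] = ∅ᴹ
  dualMS ((l , m , x) ∷ xs) =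
    (single (l ↑ˡ nM) x ∪ᴹ single (nL ↑ʳ m) (dual x)) ∪ᴹ dualMS xs

  IsDual : Lab → Set
  IsDual d = ∃ λ (xs : List (Fin nL × Fin nM × Fin nA)) →
             All (λ { (l , m , _) → map l ≡ just m }) xs × d ≡ dualMS xs

  module _ (𝐀 : LTS (Mset nL nA)) (𝐂 : LTS (Mset nM nA)) where
    open LTS 𝐀 renaming (State to SA; init to sA; _⟶⟨_⟩_ to _⟶A⟨_⟩_)
    open LTS 𝐂 renaming (State to SC; init to sC; _⟶⟨_⟩_ to _⟶C⟨_⟩_)

    data Step : SA × SC → Lab → SA × SC → Set where
      left  : ∀ {uA tA uC a} → OffDom a → uA ⟶A⟨ a ⟩ tA →
              Step (uA , uC) (embedL a) (tA , uC)
      right : ∀ {uA uC tC a} → OffRng a → uC ⟶C⟨ a ⟩ tC →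
              Step (uA , uC) (embedM a) (uA , tC)
      sync  : ∀ {uA tA uC tC a d b c} → InN a → IsDual d →
              uA ⟶A⟨ b ⟩ tA → uC ⟶C⟨ c ⟩ tC →
              a ∪ᴹ d ≡ embedL b ∪ᴹ embedM c →
              Step (uA , uC) a (tA , tC)

    par : LTS Lab
    par = record { State = SA × SC ; init = (sA , sC) ; _⟶⟨_⟩_ = Step }

par : ∀ {nA nL nM} (D : Involution nA) (𝐀 : LTS (Mset nL nA))
      (σ : PInj nL nM) (𝐂 : LTS (Mset nM nA)) → LTS (Mset (nL + nM) nA)
par D 𝐀 σ 𝐂 = Composition.par D σ 𝐀 𝐂

-- The relation "A-components related by the bisimulation, C-components equal" is a
-- weak bisimulation.  A step of A ‖ C that moves A is answered by the weak response of
-- B, carried along the same rule of the composition; silent steps of B lift to silent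
-- steps of B ‖ C.  The only delicate case is a synchronisation in which A moves silently
-- and B answers by doing nothing: a silent move of A cannot meet a non-empty σ-dual
-- multiset, so the synchronisation is really a move of C alone.
module Submission where

open import Defs
open import Data.Nat using (ℕ; zero; suc; _+_) renaming (_≟_ to _≟ℕ_)
open import Data.Nat.Properties using (+-identityˡ; +-identityʳ; m+n≡0⇒n≡0)
open import Data.Fin using (Fin; _↑ˡ_; _↑ʳ_) renaming (_≟_ to _≟ᶠ_)
open import Data.Vec using (_∷_; replicate; zipWith; tabulate; lookup; _++_)
open import Data.Vec.Properties
  using (≡-dec; zipWith-identityˡ; zipWith-identityʳ; lookup-zipWith; lookup-replicate;
         lookup∘tabulate; lookup-++ˡ; lookup-++ʳ)
open import Data.Product using (∃; ∃₂; _×_; _,_)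
open import Data.Product.Relation.Binary.Pointwise.NonDependent using (Pointwise)
open import Data.Sum using (_⊎_; inj₁; inj₂)
open import Data.List using ([]; _∷_)
open import Data.Bool using (if_then_else_; _∧_)
open import Relation.Nullary using (yes; no; contradiction)
open import Relation.Nullary.Decidable using (⌊_⌋)
open import Relation.Binary.Definitions using (DecidableEquality)
open import Relation.Binary.PropositionalEquality
  using (_≡_; _≢_; refl; sym; trans; cong; subst; module ≡-Reasoning)
open import Relation.Binary.Construct.Closure.ReflexiveTransitive
  using (Star; ε; _◅_; _◅◅_; gmap)
open import Function using (flip)

module _ {Lab : Set} {∅ : Lab} {T : LTS Lab} where
  open LTS T

  Weak-intro : DecidableEquality Lab →
               ∀ {u v v′ w a} → Star (τ-step ∅ T) u v → v ⟶⟨ a ⟩ v′ →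
               Star (τ-step ∅ T) v′ w → Weak ∅ T u a w
  Weak-intro _≟_ {a = a} s₁ st s₂ with a ≟ ∅
  ... | yes refl = weak-∅ (s₁ ◅◅ st ◅ s₂)
  ... | no a≢∅   = weak-a a≢∅ s₁ st s₂

  Weak-view : ∀ {u a w} → Weak ∅ T u a w →
              (a ≡ ∅ × u ≡ w) ⊎
              ∃₂ λ v v′ → Star (τ-step ∅ T) u v × v ⟶⟨ a ⟩ v′ × Star (τ-step ∅ T) v′ w
  Weak-view (weak-∅ ε)          = inj₁ (refl , refl)
  Weak-view (weak-∅ (st ◅ s))   = inj₂ (_ , _ , ε , st , s)
  Weak-view (weak-a _ s₁ st s₂) = inj₂ (_ , _ , s₁ , st , s₂)

WeakSimulation : {Lab : Set} (∅ : Lab) (T U : LTS Lab) →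
                 (LTS.State T → LTS.State U → Set) → Set
WeakSimulation ∅ T U R =
  ∀ {u t a v} → R u t → LTS._⟶⟨_⟩_ T u a v →
  ∃ λ w → Weak ∅ U t a w × R v w

replicate-++ : ∀ {A : Set} m n (z : A) → replicate m z ++ replicate n z ≡ replicate (m + n) z
replicate-++ zero    n z = refl
replicate-++ (suc m) n z = cong (z ∷_) (replicate-++ m n z)

module _ {n k : ℕ} where

  ≡-decᴹ : DecidableEquality (Mset n k)
  ≡-decᴹ = ≡-dec (≡-dec _≟ℕ_)

  ∪ᴹ-identityˡ : ∀ (p : Mset n k) → ∅ᴹ ∪ᴹ p ≡ p
  ∪ᴹ-identityˡ = zipWith-identityˡ (zipWith-identityˡ +-identityˡ)

  ∪ᴹ-identityʳ : ∀ (p : Mset n k) → p ∪ᴹ ∅ᴹ ≡ p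
  ∪ᴹ-identityʳ = zipWith-identityʳ (zipWith-identityʳ +-identityʳ)

  mult-∪ᴹ : ∀ (p q : Mset n k) i x → mult (p ∪ᴹ q) i x ≡ mult p i x + mult q i x
  mult-∪ᴹ p q i x rewrite lookup-zipWith (zipWith _+_) i p q =
    lookup-zipWith _+_ x (lookup p i) (lookup q i)

  mult-∅ᴹ : ∀ i x → mult (∅ᴹ {n} {k}) i x ≡ 0
  mult-∅ᴹ i x rewrite lookup-replicate i (replicate k 0) = lookup-replicate x 0

  mult-single : ∀ (i : Fin n) (x : Fin k) → mult (single i x) i x ≡ 1
  mult-single i x
    rewrite lookup∘tabulate (λ j → tabulate λ y →
                               if ⌊ i ≟ᶠ j ⌋ ∧ ⌊ x ≟ᶠ y ⌋ then 1 else 0) i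
          | lookup∘tabulate (λ y → if ⌊ i ≟ᶠ i ⌋ ∧ ⌊ x ≟ᶠ y ⌋ then 1 else 0) x
    with i ≟ᶠ i | x ≟ᶠ x
  ... | yes _  | yes _  = refl
  ... | no i≢i | _      = contradiction refl i≢i
  ... | yes _  | no x≢x = contradiction refl x≢x

module _ {nA nL nM : ℕ} (D : Involution nA) (σ : PInj nL nM) where
  open Composition D σ hiding (par)

  embedL-∅ᴹ : embedL ∅ᴹ ≡ ∅ᴹ
  embedL-∅ᴹ = replicate-++ nL nM _

  OffDom-∅ᴹ : OffDom ∅ᴹ
  OffDom-∅ᴹ l _ x _ = mult-∅ᴹ l x

  mult-embedM-↑ˡ : ∀ (c : Mset nM nA) l x → mult (embedM c) (l ↑ˡ nM) x ≡ 0
  mult-embedM-↑ˡ c l x =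
    trans (cong (λ r → lookup r x) (lookup-++ˡ (∅ᴹ {nL}) c l)) (mult-∅ᴹ l x)

  mult-embedM-↑ʳ : ∀ (c : Mset nM nA) m x → mult (embedM c) (nL ↑ʳ m) x ≡ mult c m x
  mult-embedM-↑ʳ c m x = cong (λ r → lookup r x) (lookup-++ʳ (∅ᴹ {nL}) c m)

  InN-embedM⇒OffRng : ∀ {c} → InN (embedM c) → OffRng c
  InN-embedM⇒OffRng {c} inN l m x σl≡m =
    trans (sym (mult-embedM-↑ʳ c m x)) (inN (nL ↑ʳ m) x (l , m , σl≡m , inj₂ refl))

  mult-dualMS-head≢0 : ∀ l m x xs → mult (dualMS ((l , m , x) ∷ xs)) (l ↑ˡ nM) x ≢ 0
  mult-dualMS-head≢0 l m x xs
    rewrite mult-∪ᴹ (single (l ↑ˡ nM) x ∪ᴹ single (nL ↑ʳ m) (Involution.dual D x))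
                    (dualMS xs) (l ↑ˡ nM) x
          | mult-∪ᴹ (single (l ↑ˡ nM) x) (single (nL ↑ʳ m) (Involution.dual D x)) (l ↑ˡ nM) x
          | mult-single (l ↑ˡ nM) x
          = λ ()

  -- A non-empty σ-dual multiset occupies a location of L, where embedM c is empty.
  IsDual-∪ᴹ-embedM : ∀ {a d c} → IsDual d → a ∪ᴹ d ≡ embedM c → d ≡ ∅ᴹ
  IsDual-∪ᴹ-embedM ([] , _ , refl) _ = refl
  IsDual-∪ᴹ-embedM {a} {d} {c} (((l , m , x) ∷ xs) , _ , refl) eq =
    contradiction (m+n≡0⇒n≡0 (mult a i x) a∪d≡0) (mult-dualMS-head≢0 l m x xs)
    where
    i = l ↑ˡ nM
    open ≡-Reasoning
    a∪d≡0 : mult a i x + mult d i x ≡ 0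
    a∪d≡0 = begin
      mult a i x + mult d i x  ≡⟨ sym (mult-∪ᴹ a d i x) ⟩
      mult (a ∪ᴹ d) i x        ≡⟨ cong (λ p → mult p i x) eq ⟩
      mult (embedM c) i x      ≡⟨ mult-embedM-↑ˡ c l x ⟩
      0                        ∎

  sync-silentˡ : ∀ {a d c} → InN a → IsDual d → a ∪ᴹ d ≡ embedL ∅ᴹ ∪ᴹ embedM c →
                 a ≡ embedM c × OffRng c
  sync-silentˡ {a} {d} {c} inN isDual eq = a≡c , InN-embedM⇒OffRng (subst InN a≡c inN)
    where
    open ≡-Reasoning
    eq′ : a ∪ᴹ d ≡ embedM c
    eq′ = trans eq (trans (cong (_∪ᴹ embedM c) embedL-∅ᴹ) (∪ᴹ-identityˡ (embedM c)))
    a≡c : a ≡ embedM c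
    a≡c = begin
      a             ≡⟨ sym (∪ᴹ-identityʳ a) ⟩
      a ∪ᴹ ∅ᴹ       ≡⟨ cong (a ∪ᴹ_) (sym (IsDual-∪ᴹ-embedM isDual eq′)) ⟩
      a ∪ᴹ d        ≡⟨ eq′ ⟩
      embedM c      ∎

  module _ {𝐀 𝐁 : LTS (Mset nL nA)} {𝐂 : LTS (Mset nM nA)}
           {R : LTS.State 𝐀 → LTS.State 𝐁 → Set}
           (simulation : WeakSimulation ∅ᴹ 𝐀 𝐁 R) where
    open LTS 𝐂 using () renaming (State to SC)

    τ*-liftˡ : ∀ {u v} (c : SC) → Star (τ-step ∅ᴹ 𝐁) u v →
               Star (τ-step ∅ᴹ (par D 𝐁 σ 𝐂)) (u , c) (v , c)
    τ*-liftˡ c = gmap (_, c) λ st → subst (λ e → Step 𝐁 𝐂 _ e _) embedL-∅ᴹ (left OffDom-∅ᴹ st)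

    idle : ∀ {u} → Weak ∅ᴹ (par D 𝐁 σ 𝐂) u (embedL ∅ᴹ) u
    idle = subst (λ e → Weak ∅ᴹ (par D 𝐁 σ 𝐂) _ e _) (sym embedL-∅ᴹ) (weak-∅ ε)

    par-simulation : ∀ {uA uB uC a vA vC} → R uA uB → Step 𝐀 𝐂 (uA , uC) a (vA , vC) →
                     ∃ λ vB → Weak ∅ᴹ (par D 𝐁 σ 𝐂) (uB , uC) a (vB , vC) × R vA vB
    par-simulation r (left off stA) with simulation r stA
    ... | vB , wk , r′ with Weak-view wk
    ...   | inj₁ (refl , refl) = vB , idle , r′
    ...   | inj₂ (_ , _ , s₁ , stB , s₂) =
      vB , Weak-intro ≡-decᴹ (τ*-liftˡ _ s₁) (left off stB) (τ*-liftˡ _ s₂) , r′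
    par-simulation r (right off stC) = _ , Weak-intro ≡-decᴹ ε (right off stC) ε , r
    par-simulation r (sync inN isDual stA stC eq) with simulation r stA
    ... | vB , wk , r′ with Weak-view wk
    ...   | inj₁ (refl , refl) with sync-silentˡ inN isDual eq
    ...     | a≡c , off =
      vB , Weak-intro ≡-decᴹ ε (subst (λ e → Step 𝐁 𝐂 _ e _) (sym a≡c) (right off stC)) ε , r′
    par-simulation r (sync inN isDual stA stC eq)
        | vB , wk , r′ | inj₂ (_ , _ , s₁ , stB , s₂) =
      vB , Weak-intro ≡-decᴹ (τ*-liftˡ _ s₁) (sync inN isDual stB stC eq) (τ*-liftˡ _ s₂) , r′

proposition2 : (nA nL nM : ℕ) (D : Involution nA)
               (𝐀 𝐁 : LTS (Mset nL nA)) (𝐂 : LTS (Mset nM nA)) (σ : PInj nL nM) →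
               WeakBisimilar ∅ᴹ 𝐀 𝐁 →
               WeakBisimilar ∅ᴹ (par D 𝐀 σ 𝐂) (par D 𝐁 σ 𝐂)
proposition2 nA nL nM D 𝐀 𝐁 𝐂 σ (R , isBisim) = Pointwise R _≡_ , record
  { init-rel = init-rel , refl
  ; forth    = forth′
  ; back     = back′
  }
  where
  open IsWeakBisim isBisim
  forth′ : WeakSimulation ∅ᴹ (par D 𝐀 σ 𝐂) (par D 𝐁 σ 𝐂) (Pointwise R _≡_)
  forth′ {_ , _} {_ , _} {v = _ , _} (r , refl) st with par-simulation D σ forth r st
  ... | vB , wk , r′ = (vB , _) , wk , r′ , refl
  back′ : WeakSimulation ∅ᴹ (par D 𝐁 σ 𝐂) (par D 𝐀 σ 𝐂) (flip (Pointwise R _≡_))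
  back′ {_ , _} {_ , _} {v = _ , _} (r , refl) st
    with par-simulation D σ (λ r′ st′ → back r′ st′) r st
  ... | vA , wk , r′ = (vA , _) , wk , r′ , refl
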